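{- Let $\phi:B_3\to\mathrm{SL}_2(\mathbb{Z})$ be the homomorphism with $\phi(\sigma_1)=\begin{bmatrix}1&1\\0&1\end{bmatrix}$ and $\phi(\sigma_2)=\begin{bmatrix}1&0\\-1&1\end{bmatrix}$, and let $\epsilon:B_3\to\mathbb{Z}$ be the homomorphism with $\epsilon(\sigma_1)=\epsilon(\sigma_2)=1$. Elements $g,h\in B_3$ are conjugate in $B_3$ if and only if $\phi(g)$ and $\phi(h)$ are conjugate in $\mathrm{SL}_2(\mathbb{Z})$ and $\epsilon(g)=\epsilon(h)$.
   Context: $B_3=\langle\sigma_1,\sigma_2:\sigma_1\sigma_2\sigma_1=\sigma_2\sigma_1\sigma_2\rangle$ is the braid group on three strands; $\epsilon$ is its abelianization (exponent sum). -}

module Defs where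

open import Data.Bool using (Bool; true; false)
open import Data.List using (List; []; _∷_; _++_; reverse; map)
open import Data.Integer using (ℤ; +_; -_; _+_; _*_; _-_)
open import Data.Product using (Σ; _×_; _,_)
open import Relation.Binary.PropositionalEquality using (_≡_)

-- The braid group B₃ = ⟨σ₁, σ₂ | σ₁σ₂σ₁ = σ₂σ₁σ₂⟩, presented by words
-- modulo the congruence generated by free cancellation and the braid
-- relation (no quotient types, so B₃-equality is the relation _≈B_).

data Gen : Set where
  σ₁ σ₂ : Gen

-- a letter is a generator with an exponent: true = +1, false = -1
Letter : Set
Letter = Gen × Bool

Word : Set
Word = List Letter

invL : Letter → Letter
invL (g , true)  = (g , false)
invL (g , false) = (g , true)

invW : Word → Word
invW w = reverse (map invL w)

s₁ s₂ : Letter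
s₁ = (σ₁ , true)
s₂ = (σ₂ , true)

data _≈B_ : Word → Word → Set where
  ≈refl  : ∀ {u} → u ≈B u
  ≈sym   : ∀ {u v} → u ≈B v → v ≈B u
  ≈trans : ∀ {u v w} → u ≈B v → v ≈B w → u ≈B w
  ≈free  : ∀ u v (l : Letter) → (u ++ (l ∷ invL l ∷ v)) ≈B (u ++ v)
  ≈braid : ∀ u v → (u ++ (s₁ ∷ s₂ ∷ s₁ ∷ v)) ≈B (u ++ (s₂ ∷ s₁ ∷ s₂ ∷ v))

ConjB : Word → Word → Set
ConjB g h = Σ Word λ w → (w ++ g ++ invW w) ≈B h

record M2 : Set where
  constructor mat
  field
    a b c d : ℤ

open M2 public

_⊗_ : M2 → M2 → M2
mat a₁ b₁ c₁ d₁ ⊗ mat a₂ b₂ c₂ d₂ =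
  mat (a₁ * a₂ + b₁ * c₂) (a₁ * b₂ + b₁ * d₂)
      (c₁ * a₂ + d₁ * c₂) (c₁ * b₂ + d₁ * d₂)

det : M2 → ℤ
det (mat a b c d) = a * d - b * c

I₂ : M2
I₂ = mat (+ 1) (+ 0) (+ 0) (+ 1)

invSL : M2 → M2
invSL (mat a b c d) = mat d (- b) (- c) a

ConjSL : M2 → M2 → Set
ConjSL A B = Σ M2 λ P → (det P ≡ + 1) × (P ⊗ (A ⊗ invSL P) ≡ B)

φL : Letter → M2
φL (σ₁ , true)  = mat (+ 1) (+ 1) (+ 0) (+ 1)
φL (σ₁ , false) = mat (+ 1) (- + 1) (+ 0) (+ 1)
φL (σ₂ , true)  = mat (+ 1) (+ 0) (- + 1) (+ 1)
φL (σ₂ , false) = mat (+ 1) (+ 0) (+ 1) (+ 1)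

φ : Word → M2
φ []      = I₂
φ (l ∷ w) = φL l ⊗ φ w

εL : Letter → ℤ
εL (_ , true)  = + 1
εL (_ , false) = - + 1

ε : Word → ℤ
ε []      = + 0
ε (l ∷ w) = εL l + ε w

{-# OPTIONS --safe #-}
-- φ is onto SL₂(ℤ) (Euclid's algorithm on the first column), so when φ h = P φ g P⁻¹ we may
-- take P = φ w, and then w g w⁻¹ h⁻¹ lies in ker φ ∩ ker ε; it remains to show that this
-- intersection is trivial. With x = σ₁σ₂σ₁ and y = σ₁σ₂ one has x² = y³ = z central, and
-- letting the generators act on normal forms shows that every braid is z^n times a reduced
-- word in x and y. Since φ z = -I and ε z = 6, it suffices that φ maps no reduced word ≠ 1
-- to ±I. Nonempty products of φ(xy) = -[[1,-1],[0,1]] and φ(xy²) = -[[1,0],[-1,1]] have a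
-- strict checkerboard sign pattern: they are not ±I, not even after multiplication by φ x,
-- and have no zero on the diagonal, unlike φ(y⁻¹) and φ(y⁻²). Every other reduced word is a
-- cyclic rotation of such a product or y^i times one.
module Submission where

open import Defs
open import Algebra.Bundles using (Monoid)
import Algebra.Properties.AbelianGroup as AbelianGroupProperties
open import Data.Bool using (Bool; true; false)
open import Data.Empty using (⊥-elim)
open import Data.Integer as ℤ using (ℤ; +_; -[1+_]; -_; _+_; _*_; _-_)
import Data.Integer.Properties as ℤ
open import Data.Integer.Tactic.RingSolver using (solve; solve-∀)
open import Data.List using (List; []; _∷_; _++_; [_]; _∷ʳ_; map; replicate)
open import Data.List.Properties using (++-assoc; ++-identityʳ; unfold-reverse)
open import Data.Nat as ℕ using (ℕ; zero; suc; _∸_; s≤s)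
import Data.Nat.Properties as ℕ
open import Data.Product using (Σ; _×_; _,_; proj₁)
open import Data.Sum using (_⊎_; inj₁; inj₂)
open import Function using (_∘_)
open import Level using (0ℓ)
open import Relation.Binary.Bundles using (Setoid)
open import Relation.Binary.PropositionalEquality
  using (_≡_; _≢_; refl; sym; trans; cong; cong₂; subst; subst₂; module ≡-Reasoning)
open import Relation.Binary.PropositionalEquality.Algebra using (isMagma)
import Relation.Binary.Reasoning.Setoid as SetoidReasoning
open import Relation.Nullary using (¬_)

≈B-setoid : Setoid 0ℓ 0ℓ
≈B-setoid = record
  { Carrier       = Word
  ; _≈_           = _≈B_
  ; isEquivalence = record { refl = ≈refl ; sym = ≈sym ; trans = ≈trans }
  }

module ≈B-Reasoning = SetoidReasoning ≈B-setoid

++-congˡ : ∀ p {u v} → u ≈B v → (p ++ u) ≈B (p ++ v)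
++-congˡ p ≈refl          = ≈refl
++-congˡ p (≈sym e)       = ≈sym (++-congˡ p e)
++-congˡ p (≈trans e e′)  = ≈trans (++-congˡ p e) (++-congˡ p e′)
++-congˡ p (≈free u v l)  =
  subst₂ _≈B_ (++-assoc p u _) (++-assoc p u v) (≈free (p ++ u) v l)
++-congˡ p (≈braid u v)   =
  subst₂ _≈B_ (++-assoc p u _) (++-assoc p u _) (≈braid (p ++ u) v)

++-congʳ : ∀ q {u v} → u ≈B v → (u ++ q) ≈B (v ++ q)
++-congʳ q ≈refl          = ≈refl
++-congʳ q (≈sym e)       = ≈sym (++-congʳ q e)
++-congʳ q (≈trans e e′)  = ≈trans (++-congʳ q e) (++-congʳ q e′)
++-congʳ q (≈free u v l)  =
  subst₂ _≈B_ (sym (++-assoc u _ q)) (sym (++-assoc u v q)) (≈free u (v ++ q) l)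
++-congʳ q (≈braid u v)   =
  subst₂ _≈B_ (sym (++-assoc u _ q)) (sym (++-assoc u _ q)) (≈braid u (v ++ q))

invL-involutive : ∀ l → invL (invL l) ≡ l
invL-involutive (_ , true)  = refl
invL-involutive (_ , false) = refl

invW-∷ : ∀ l w t → invW (l ∷ w) ++ t ≡ invW w ++ invL l ∷ t
invW-∷ l w t = begin
  invW (l ∷ w) ++ t          ≡⟨ cong (_++ t) (unfold-reverse (invL l) (map invL w)) ⟩
  (invW w ++ [ invL l ]) ++ t ≡⟨ ++-assoc (invW w) _ t ⟩
  invW w ++ invL l ∷ t        ∎
  where open ≡-Reasoning

invW-inverseʳ : ∀ w t → (w ++ invW w ++ t) ≈B t
invW-inverseʳ []      t = ≈refl
invW-inverseʳ (l ∷ w) t = begin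
  l ∷ w ++ invW (l ∷ w) ++ t    ≡⟨ cong (λ s → l ∷ w ++ s) (invW-∷ l w t) ⟩
  l ∷ w ++ invW w ++ invL l ∷ t ≈⟨ ++-congˡ [ l ] (invW-inverseʳ w (invL l ∷ t)) ⟩
  l ∷ invL l ∷ t                ≈⟨ ≈free [] t l ⟩
  t                             ∎
  where open ≈B-Reasoning

invW-inverseˡ : ∀ w t → (invW w ++ w ++ t) ≈B t
invW-inverseˡ []      t = ≈refl
invW-inverseˡ (l ∷ w) t = begin
  invW (l ∷ w) ++ l ∷ w ++ t      ≡⟨ invW-∷ l w (l ∷ w ++ t) ⟩
  invW w ++ invL l ∷ l ∷ w ++ t   ≈⟨ ++-congˡ (invW w) free ⟩
  invW w ++ w ++ t                ≈⟨ invW-inverseˡ w t ⟩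
  t                               ∎
  where
  open ≈B-Reasoning
  free : (invL l ∷ l ∷ w ++ t) ≈B (w ++ t)
  free = subst (λ l′ → (invL l ∷ l′ ∷ w ++ t) ≈B (w ++ t))
               (invL-involutive l) (≈free [] (w ++ t) (invL l))

≈B-of-inverse : ∀ u v → (u ++ invW v) ≈B [] → u ≈B v
≈B-of-inverse u v e = begin
  u                        ≡⟨ ++-identityʳ u ⟨
  u ++ []                  ≈⟨ ++-congˡ u (invW-inverseˡ v []) ⟨
  u ++ invW v ++ v ++ []   ≡⟨ ++-assoc u (invW v) (v ++ []) ⟨
  (u ++ invW v) ++ v ++ [] ≈⟨ ++-congʳ (v ++ []) e ⟩
  v ++ []                  ≡⟨ ++-identityʳ v ⟩
  v                        ∎
  where open ≈B-Reasoning

module Presentation {c ℓ} (M : Monoid c ℓ) where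
  open Monoid M
    using (Carrier; _≈_; _∙_; setoid; assoc; identityˡ; ∙-congˡ; ∙-congʳ)
    renaming (ε to 1#; refl to ≈-refl; sym to ≈-sym; trans to ≈-trans)
  open SetoidReasoning setoid

  module _ (f : Letter → Carrier) (F : Word → Carrier)
           (F-[] : F [] ≈ 1#) (F-∷ : ∀ l w → F (l ∷ w) ≈ f l ∙ F w) where

    hom-++ : ∀ u v → F (u ++ v) ≈ F u ∙ F v
    hom-++ []      v = begin
      F v        ≈⟨ identityˡ (F v) ⟨
      1# ∙ F v   ≈⟨ ∙-congʳ F-[] ⟨
      F [] ∙ F v ∎
    hom-++ (l ∷ u) v = begin
      F (l ∷ u ++ v)    ≈⟨ F-∷ l (u ++ v) ⟩
      f l ∙ F (u ++ v)  ≈⟨ ∙-congˡ (hom-++ u v) ⟩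
      f l ∙ (F u ∙ F v) ≈⟨ assoc (f l) (F u) (F v) ⟨
      f l ∙ F u ∙ F v   ≈⟨ ∙-congʳ (F-∷ l u) ⟨
      F (l ∷ u) ∙ F v   ∎

    module _ (f-inverse : ∀ l → f l ∙ f (invL l) ≈ 1#)
             (f-braid : f s₁ ∙ (f s₂ ∙ f s₁) ≈ f s₂ ∙ (f s₁ ∙ f s₂)) where

      private
        F-∷∷ : ∀ l l′ w → F (l ∷ l′ ∷ w) ≈ f l ∙ f l′ ∙ F w
        F-∷∷ l l′ w = begin
          F (l ∷ l′ ∷ w)       ≈⟨ F-∷ l _ ⟩
          f l ∙ F (l′ ∷ w)     ≈⟨ ∙-congˡ (F-∷ l′ w) ⟩
          f l ∙ (f l′ ∙ F w)   ≈⟨ assoc _ _ _ ⟨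
          f l ∙ f l′ ∙ F w     ∎

        F-cancel : ∀ l w → F (l ∷ invL l ∷ w) ≈ F w
        F-cancel l w = begin
          F (l ∷ invL l ∷ w)       ≈⟨ F-∷∷ l (invL l) w ⟩
          f l ∙ f (invL l) ∙ F w   ≈⟨ ∙-congʳ (f-inverse l) ⟩
          1# ∙ F w                 ≈⟨ identityˡ (F w) ⟩
          F w                      ∎

        F-braid : ∀ w → F (s₁ ∷ s₂ ∷ s₁ ∷ w) ≈ F (s₂ ∷ s₁ ∷ s₂ ∷ w)
        F-braid w = begin
          F (s₁ ∷ s₂ ∷ s₁ ∷ w)             ≈⟨ F-∷ s₁ _ ⟩
          f s₁ ∙ F (s₂ ∷ s₁ ∷ w)           ≈⟨ ∙-congˡ (F-∷∷ s₂ s₁ w) ⟩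
          f s₁ ∙ (f s₂ ∙ f s₁ ∙ F w)       ≈⟨ assoc _ _ _ ⟨
          f s₁ ∙ (f s₂ ∙ f s₁) ∙ F w       ≈⟨ ∙-congʳ f-braid ⟩
          f s₂ ∙ (f s₁ ∙ f s₂) ∙ F w       ≈⟨ assoc _ _ _ ⟩
          f s₂ ∙ (f s₁ ∙ f s₂ ∙ F w)       ≈⟨ ∙-congˡ (F-∷∷ s₁ s₂ w) ⟨
          f s₂ ∙ F (s₁ ∷ s₂ ∷ w)           ≈⟨ F-∷ s₂ _ ⟨
          F (s₂ ∷ s₁ ∷ s₂ ∷ w)             ∎

        F-in-context : ∀ u {v v′} → F v ≈ F v′ → F (u ++ v) ≈ F (u ++ v′)
        F-in-context u {v} {v′} e = begin
          F (u ++ v)  ≈⟨ hom-++ u v ⟩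
          F u ∙ F v   ≈⟨ ∙-congˡ e ⟩
          F u ∙ F v′  ≈⟨ hom-++ u v′ ⟨
          F (u ++ v′) ∎

      hom-resp : ∀ {u v} → u ≈B v → F u ≈ F v
      hom-resp ≈refl          = ≈-refl
      hom-resp (≈sym e)       = ≈-sym (hom-resp e)
      hom-resp (≈trans e e′)  = ≈-trans (hom-resp e) (hom-resp e′)
      hom-resp (≈free u v l)  = F-in-context u (F-cancel l v)
      hom-resp (≈braid u v)   = F-in-context u (F-braid v)

mat-cong : ∀ {a b c d a′ b′ c′ d′ : ℤ} →
           a ≡ a′ → b ≡ b′ → c ≡ c′ → d ≡ d′ → mat a b c d ≡ mat a′ b′ c′ d′
mat-cong refl refl refl refl = refl

⊗-assoc : ∀ M N K → (M ⊗ N) ⊗ K ≡ M ⊗ (N ⊗ K)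
⊗-assoc (mat a₁ b₁ c₁ d₁) (mat a₂ b₂ c₂ d₂) (mat a₃ b₃ c₃ d₃) =
  mat-cong (entry a₁ b₁ a₃ c₃) (entry a₁ b₁ b₃ d₃) (entry c₁ d₁ a₃ c₃) (entry c₁ d₁ b₃ d₃)
  where
  entry : ∀ x y z w → (x * a₂ + y * c₂) * z + (x * b₂ + y * d₂) * w
                    ≡ x * (a₂ * z + b₂ * w) + y * (c₂ * z + d₂ * w)
  entry x y z w = solve (x ∷ y ∷ z ∷ w ∷ a₂ ∷ b₂ ∷ c₂ ∷ d₂ ∷ [])

⊗-identityˡ : ∀ M → I₂ ⊗ M ≡ M
⊗-identityˡ (mat a b c d) =
  mat-cong (solve (a ∷ c ∷ [])) (solve (b ∷ d ∷ [])) (solve (a ∷ c ∷ [])) (solve (b ∷ d ∷ []))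

⊗-identityʳ : ∀ M → M ⊗ I₂ ≡ M
⊗-identityʳ (mat a b c d) =
  mat-cong (solve (a ∷ b ∷ [])) (solve (a ∷ b ∷ [])) (solve (c ∷ d ∷ [])) (solve (c ∷ d ∷ []))

M2-monoid : Monoid 0ℓ 0ℓ
M2-monoid = record
  { Carrier  = M2
  ; _≈_      = _≡_
  ; _∙_      = _⊗_
  ; ε        = I₂
  ; isMonoid = record
    { isSemigroup = record { isMagma = isMagma _⊗_ ; assoc = ⊗-assoc }
    ; identity    = ⊗-identityˡ , ⊗-identityʳ
    }
  }

det-⊗ : ∀ M N → det (M ⊗ N) ≡ det M * det N
det-⊗ (mat a₁ b₁ c₁ d₁) (mat a₂ b₂ c₂ d₂) = expand
  where
  expand : (a₁ * a₂ + b₁ * c₂) * (c₁ * b₂ + d₁ * d₂) - (a₁ * b₂ + b₁ * d₂) * (c₁ * a₂ + d₁ * c₂)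
         ≡ (a₁ * d₁ - b₁ * c₁) * (a₂ * d₂ - b₂ * c₂)
  expand = solve (a₁ ∷ b₁ ∷ c₁ ∷ d₁ ∷ a₂ ∷ b₂ ∷ c₂ ∷ d₂ ∷ [])

invSL-inverseʳ : ∀ M → det M ≡ + 1 → M ⊗ invSL M ≡ I₂
invSL-inverseʳ (mat a b c d) det≡1 =
  mat-cong (trans diagonal det≡1) upper lower (trans diagonal′ det≡1)
  where
  diagonal : a * d + b * - c ≡ a * d - b * c
  diagonal = solve (a ∷ b ∷ c ∷ d ∷ [])
  diagonal′ : c * - b + d * a ≡ a * d - b * c
  diagonal′ = solve (a ∷ b ∷ c ∷ d ∷ [])
  upper : a * - b + b * a ≡ + 0
  upper = solve (a ∷ b ∷ [])
  lower : c * d + d * - c ≡ + 0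
  lower = solve (c ∷ d ∷ [])

invSL-inverseˡ : ∀ M → det M ≡ + 1 → invSL M ⊗ M ≡ I₂
invSL-inverseˡ (mat a b c d) det≡1 =
  mat-cong (trans diagonal det≡1) upper lower (trans diagonal′ det≡1)
  where
  diagonal : d * a + - b * c ≡ a * d - b * c
  diagonal = solve (a ∷ b ∷ c ∷ d ∷ [])
  diagonal′ : - c * b + a * d ≡ a * d - b * c
  diagonal′ = solve (a ∷ b ∷ c ∷ d ∷ [])
  upper : d * b + - b * d ≡ + 0
  upper = solve (b ∷ d ∷ [])
  lower : - c * a + a * c ≡ + 0
  lower = solve (a ∷ c ∷ [])

invSL-unique : ∀ {M N} → det M ≡ + 1 → N ⊗ M ≡ I₂ → N ≡ invSL M
invSL-unique {M} {N} det≡1 NM≡I = begin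
  N                     ≡⟨ ⊗-identityʳ N ⟨
  N ⊗ I₂                ≡⟨ cong (N ⊗_) (invSL-inverseʳ M det≡1) ⟨
  N ⊗ (M ⊗ invSL M)     ≡⟨ ⊗-assoc N M (invSL M) ⟨
  (N ⊗ M) ⊗ invSL M     ≡⟨ cong (_⊗ invSL M) NM≡I ⟩
  I₂ ⊗ invSL M          ≡⟨ ⊗-identityˡ (invSL M) ⟩
  invSL M               ∎
  where open ≡-Reasoning

-I₂ : M2
-I₂ = mat -[1+ 0 ] (+ 0) (+ 0) -[1+ 0 ]

±I : M2 → Set
±I E = E ≡ I₂ ⊎ E ≡ -I₂

±I-⊗ : ∀ {E E′} → ±I E → ±I E′ → ±I (E ⊗ E′)
±I-⊗ (inj₁ refl) (inj₁ refl) = inj₁ refl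
±I-⊗ (inj₁ refl) (inj₂ refl) = inj₂ refl
±I-⊗ (inj₂ refl) (inj₁ refl) = inj₂ refl
±I-⊗ (inj₂ refl) (inj₂ refl) = inj₁ refl

±I-central : ∀ {E} → ±I E → ∀ M → E ⊗ M ≡ M ⊗ E
±I-central (inj₁ refl) M             = trans (⊗-identityˡ M) (sym (⊗-identityʳ M))
±I-central (inj₂ refl) (mat a b c d) = mat-cong upper-left upper-right lower-left lower-right
  where
  upper-left : -[1+ 0 ] * a + + 0 * c ≡ a * -[1+ 0 ] + b * + 0
  upper-left = solve (a ∷ b ∷ c ∷ [])
  upper-right : -[1+ 0 ] * b + + 0 * d ≡ a * + 0 + b * -[1+ 0 ]
  upper-right = solve (a ∷ b ∷ d ∷ [])
  lower-left : + 0 * a + -[1+ 0 ] * c ≡ c * -[1+ 0 ] + d * + 0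
  lower-left = solve (a ∷ c ∷ d ∷ [])
  lower-right : + 0 * b + -[1+ 0 ] * d ≡ c * + 0 + d * -[1+ 0 ]
  lower-right = solve (b ∷ c ∷ d ∷ [])

±I-self-inverse : ∀ {E} → ±I E → E ⊗ E ≡ I₂
±I-self-inverse (inj₁ refl) = refl
±I-self-inverse (inj₂ refl) = refl

±I-cancel : ∀ {E M} → ±I E → E ⊗ M ≡ I₂ → ±I M
±I-cancel {E} {M} ±I-E EM≡I = subst ±I (sym M≡E) ±I-E
  where
  open ≡-Reasoning
  M≡E : M ≡ E
  M≡E = begin
    M             ≡⟨ ⊗-identityˡ M ⟨
    I₂ ⊗ M        ≡⟨ cong (_⊗ M) (±I-self-inverse ±I-E) ⟨
    (E ⊗ E) ⊗ M   ≡⟨ ⊗-assoc E E M ⟩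
    E ⊗ (E ⊗ M)   ≡⟨ cong (E ⊗_) EM≡I ⟩
    E ⊗ I₂        ≡⟨ ⊗-identityʳ E ⟩
    E             ∎

±I-commute : ∀ {M N} → det M ≡ + 1 → ±I (M ⊗ N) → N ⊗ M ≡ M ⊗ N
±I-commute {M} {N} det≡1 ±I-MN = begin
  N ⊗ M                        ≡⟨ cong (_⊗ M) N≡ ⟩
  (invSL M ⊗ (M ⊗ N)) ⊗ M      ≡⟨ ⊗-assoc (invSL M) (M ⊗ N) M ⟩
  invSL M ⊗ ((M ⊗ N) ⊗ M)      ≡⟨ cong (invSL M ⊗_) (±I-central ±I-MN M) ⟩
  invSL M ⊗ (M ⊗ (M ⊗ N))      ≡⟨ ⊗-assoc (invSL M) M (M ⊗ N) ⟨
  (invSL M ⊗ M) ⊗ (M ⊗ N)      ≡⟨ cong (_⊗ (M ⊗ N)) (invSL-inverseˡ M det≡1) ⟩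
  I₂ ⊗ (M ⊗ N)                 ≡⟨ ⊗-identityˡ (M ⊗ N) ⟩
  M ⊗ N                        ∎
  where
  open ≡-Reasoning
  N≡ : N ≡ invSL M ⊗ (M ⊗ N)
  N≡ = begin
    N                     ≡⟨ ⊗-identityˡ N ⟨
    I₂ ⊗ N                ≡⟨ cong (_⊗ N) (invSL-inverseˡ M det≡1) ⟨
    (invSL M ⊗ M) ⊗ N     ≡⟨ ⊗-assoc (invSL M) M N ⟩
    invSL M ⊗ (M ⊗ N)     ∎

φL-inverse : ∀ l → φL l ⊗ φL (invL l) ≡ I₂
φL-inverse (σ₁ , true)  = refl
φL-inverse (σ₁ , false) = refl
φL-inverse (σ₂ , true)  = refl
φL-inverse (σ₂ , false) = refl

φ-++ : ∀ u v → φ (u ++ v) ≡ φ u ⊗ φ v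
φ-++ = Presentation.hom-++ M2-monoid φL φ refl (λ _ _ → refl)

φ-resp : ∀ {u v} → u ≈B v → φ u ≡ φ v
φ-resp = Presentation.hom-resp M2-monoid φL φ refl (λ _ _ → refl) φL-inverse refl

det-φL : ∀ l → det (φL l) ≡ + 1
det-φL (σ₁ , true)  = refl
det-φL (σ₁ , false) = refl
det-φL (σ₂ , true)  = refl
det-φL (σ₂ , false) = refl

det-φ : ∀ w → det (φ w) ≡ + 1
det-φ []      = refl
det-φ (l ∷ w) = trans (det-⊗ (φL l) (φ w)) (cong₂ _*_ (det-φL l) (det-φ w))

φ-cancelˡ : ∀ u v → φ v ≡ φ (invW u) ⊗ φ (u ++ v)
φ-cancelˡ u v = begin
  φ v                        ≡⟨ φ-resp (invW-inverseˡ u v) ⟨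
  φ (invW u ++ u ++ v)       ≡⟨ φ-++ (invW u) (u ++ v) ⟩
  φ (invW u) ⊗ φ (u ++ v)    ∎
  where open ≡-Reasoning

φ-invW : ∀ w → φ (invW w) ≡ invSL (φ w)
φ-invW w = invSL-unique (det-φ w) (begin
  φ (invW w) ⊗ φ w    ≡⟨ φ-++ (invW w) w ⟨
  φ (invW w ++ w)     ≡⟨ cong (λ v → φ (invW w ++ v)) (++-identityʳ w) ⟨
  φ (invW w ++ w ++ []) ≡⟨ φ-resp (invW-inverseˡ w []) ⟩
  I₂                  ∎)
  where open ≡-Reasoning

φ-conj : ∀ w g → φ (w ++ g ++ invW w) ≡ φ w ⊗ (φ g ⊗ invSL (φ w))
φ-conj w g = begin
  φ (w ++ g ++ invW w)           ≡⟨ φ-++ w (g ++ invW w) ⟩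
  φ w ⊗ φ (g ++ invW w)          ≡⟨ cong (φ w ⊗_) (φ-++ g (invW w)) ⟩
  φ w ⊗ (φ g ⊗ φ (invW w))       ≡⟨ cong (λ P → φ w ⊗ (φ g ⊗ P)) (φ-invW w) ⟩
  φ w ⊗ (φ g ⊗ invSL (φ w))      ∎
  where open ≡-Reasoning

±I-φ-rotate : ∀ u v → ±I (φ (u ++ v)) → ±I (φ (v ++ u))
±I-φ-rotate u v ±I-uv = subst ±I (sym φvu≡φuv) ±I-uv
  where
  open ≡-Reasoning
  φvu≡φuv : φ (v ++ u) ≡ φ (u ++ v)
  φvu≡φuv = begin
    φ (v ++ u)  ≡⟨ φ-++ v u ⟩
    φ v ⊗ φ u   ≡⟨ ±I-commute {φ u} {φ v} (det-φ u) (subst ±I (φ-++ u v) ±I-uv) ⟩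
    φ u ⊗ φ v   ≡⟨ φ-++ u v ⟨
    φ (u ++ v)  ∎

εL-inverse : ∀ l → εL l + εL (invL l) ≡ + 0
εL-inverse (_ , true)  = refl
εL-inverse (_ , false) = refl

ε-++ : ∀ u v → ε (u ++ v) ≡ ε u + ε v
ε-++ = Presentation.hom-++ ℤ.+-0-monoid εL ε refl (λ _ _ → refl)

ε-resp : ∀ {u v} → u ≈B v → ε u ≡ ε v
ε-resp = Presentation.hom-resp ℤ.+-0-monoid εL ε refl (λ _ _ → refl) εL-inverse refl

open AbelianGroupProperties ℤ.+-0-abelianGroup using (inverseˡ-unique; xyx⁻¹≈y)

ε-invW : ∀ w → ε (invW w) ≡ - ε w
ε-invW w = inverseˡ-unique (ε (invW w)) (ε w) (begin
  ε (invW w) + ε w        ≡⟨ ε-++ (invW w) w ⟨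
  ε (invW w ++ w)         ≡⟨ cong (λ v → ε (invW w ++ v)) (++-identityʳ w) ⟨
  ε (invW w ++ w ++ [])   ≡⟨ ε-resp (invW-inverseˡ w []) ⟩
  + 0                     ∎)
  where open ≡-Reasoning

ε-conj : ∀ w g → ε (w ++ g ++ invW w) ≡ ε g
ε-conj w g = begin
  ε (w ++ g ++ invW w)       ≡⟨ ε-++ w (g ++ invW w) ⟩
  ε w + ε (g ++ invW w)      ≡⟨ cong (λ i → ε w + i) (ε-++ g (invW w)) ⟩
  ε w + (ε g + ε (invW w))   ≡⟨ cong (λ i → ε w + (ε g + i)) (ε-invW w) ⟩
  ε w + (ε g + - ε w)        ≡⟨ ℤ.+-assoc (ε w) (ε g) (- ε w) ⟨
  ε w + ε g + - ε w          ≡⟨ xyx⁻¹≈y (ε w) (ε g) ⟩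
  ε g                        ∎
  where open ≡-Reasoning

-- The elements x = σ₁σ₂σ₁, y = σ₁σ₂ and z = x² = y³

X Y Z Z⁻¹ : Word
X   = s₁ ∷ s₂ ∷ s₁ ∷ []
Y   = s₁ ∷ s₂ ∷ []
Z   = X ++ X
Z⁻¹ = invW Z

Z≈Y³ : ∀ t → (Z ++ t) ≈B (Y ++ Y ++ Y ++ t)
Z≈Y³ t = ≈braid X t

Commute : Word → Word → Set
Commute u v = ∀ t → (u ++ v ++ t) ≈B (v ++ u ++ t)

infixl 8 _^_

_^_ : Word → ℕ → Word
w ^ zero  = []
w ^ suc k = w ^ k ++ w

commute-^ : ∀ {u v} → Commute u v → ∀ k → Commute u (v ^ k)
commute-^         uv zero    t = ≈refl
commute-^ {u} {v} uv (suc k) t = begin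
  u ++ (v ^ k ++ v) ++ t   ≡⟨ cong (u ++_) (++-assoc (v ^ k) v t) ⟩
  u ++ v ^ k ++ v ++ t     ≈⟨ commute-^ uv k (v ++ t) ⟩
  v ^ k ++ u ++ v ++ t     ≈⟨ ++-congˡ (v ^ k) (uv t) ⟩
  v ^ k ++ v ++ u ++ t     ≡⟨ ++-assoc (v ^ k) v (u ++ t) ⟨
  (v ^ k ++ v) ++ u ++ t   ∎
  where open ≈B-Reasoning

commute-invW : ∀ {u v} → Commute u v → Commute u (invW v)
commute-invW {u} {v} uv t = begin
  u ++ invW v ++ t                  ≈⟨ invW-inverseˡ v (u ++ invW v ++ t) ⟨
  invW v ++ v ++ u ++ invW v ++ t   ≈⟨ ++-congˡ (invW v) (uv (invW v ++ t)) ⟨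
  invW v ++ u ++ v ++ invW v ++ t   ≈⟨ ++-congˡ (invW v) (++-congˡ u (invW-inverseʳ v t)) ⟩
  invW v ++ u ++ t                  ∎
  where open ≈B-Reasoning

Z^ : ℤ → Word
Z^ (+ k)    = Z ^ k
Z^ -[1+ k ] = Z⁻¹ ^ suc k

commute-Z^ : ∀ {u} → Commute u Z → ∀ n → Commute u (Z^ n)
commute-Z^ uZ (+ k)    = commute-^ uZ k
commute-Z^ uZ -[1+ k ] = commute-^ (commute-invW {v = Z} uZ) (suc k)

X-Z : Commute X Z
X-Z t = ≈refl

Y-Z : Commute Y Z
Y-Z t = begin
  Y ++ Z ++ t              ≈⟨ ++-congˡ Y (Z≈Y³ t) ⟩
  Y ++ Y ++ Y ++ Y ++ t    ≈⟨ Z≈Y³ (Y ++ t) ⟨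
  Z ++ Y ++ t              ∎
  where open ≈B-Reasoning

Z⁻¹-Z : Commute Z⁻¹ Z
Z⁻¹-Z t = ≈trans (invW-inverseˡ Z t) (≈sym (invW-inverseʳ Z t))

Z^-Z : ∀ n t → (Z^ n ++ Z ++ t) ≈B (Z^ (ℤ.suc n) ++ t)
Z^-Z (+ k)          t = subst (_≈B ((Z ^ k ++ Z) ++ t)) (++-assoc (Z ^ k) Z t) ≈refl
Z^-Z -[1+ zero ]    t = invW-inverseˡ Z t
Z^-Z -[1+ suc k ]   t = begin
  (Z⁻¹ ^ suc k ++ Z⁻¹) ++ Z ++ t   ≡⟨ ++-assoc (Z⁻¹ ^ suc k) Z⁻¹ (Z ++ t) ⟩
  Z⁻¹ ^ suc k ++ Z⁻¹ ++ Z ++ t     ≈⟨ ++-congˡ (Z⁻¹ ^ suc k) (invW-inverseˡ Z t) ⟩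
  Z⁻¹ ^ suc k ++ t                 ∎
  where open ≈B-Reasoning

Z⁻¹-Z^ : ∀ n t → (Z⁻¹ ++ Z^ n ++ t) ≈B (Z^ (ℤ.pred n) ++ t)
Z⁻¹-Z^ n t = ≈trans (commute-Z^ Z⁻¹-Z n t) (Z^-Z⁻¹ n)
  where
  open ≈B-Reasoning
  Z^-Z⁻¹ : ∀ n → (Z^ n ++ Z⁻¹ ++ t) ≈B (Z^ (ℤ.pred n) ++ t)
  Z^-Z⁻¹ (+ zero)   = ≈refl
  Z^-Z⁻¹ (+ suc k)  = begin
    (Z ^ k ++ Z) ++ Z⁻¹ ++ t   ≡⟨ ++-assoc (Z ^ k) Z (Z⁻¹ ++ t) ⟩
    Z ^ k ++ Z ++ Z⁻¹ ++ t     ≈⟨ ++-congˡ (Z ^ k) (invW-inverseʳ Z t) ⟩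
    Z ^ k ++ t                 ∎
  Z^-Z⁻¹ -[1+ k ]   = subst (_≈B (Z^ -[1+ suc k ] ++ t)) (++-assoc (Z⁻¹ ^ suc k) Z⁻¹ t) ≈refl

±I-φ-^ : ∀ {w} → ±I (φ w) → ∀ k → ±I (φ (w ^ k))
±I-φ-^     ±I-w zero    = inj₁ refl
±I-φ-^ {w} ±I-w (suc k) = subst ±I (sym (φ-++ (w ^ k) w)) (±I-⊗ (±I-φ-^ ±I-w k) ±I-w)

±I-φ-Z^ : ∀ n → ±I (φ (Z^ n))
±I-φ-Z^ (+ k)    = ±I-φ-^ (inj₂ refl) k
±I-φ-Z^ -[1+ k ] = ±I-φ-^ (inj₂ refl) (suc k)

ε-^ : ∀ w k → ε (w ^ k) ≡ + k * ε w
ε-^ w zero    = refl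
ε-^ w (suc k) = begin
  ε (w ^ k ++ w)     ≡⟨ ε-++ (w ^ k) w ⟩
  ε (w ^ k) + ε w    ≡⟨ cong (_+ ε w) (ε-^ w k) ⟩
  + k * ε w + ε w    ≡⟨ ℤ.+-comm (+ k * ε w) (ε w) ⟩
  ε w + + k * ε w    ≡⟨ ℤ.suc-* (+ k) (ε w) ⟨
  + suc k * ε w      ∎
  where open ≡-Reasoning

ε-Z^ : ∀ n → ε (Z^ n) ≡ n * + 6
ε-Z^ (+ k)    = ε-^ Z k
ε-Z^ -[1+ k ] = begin
  ε (Z⁻¹ ^ suc k)        ≡⟨ ε-^ Z⁻¹ (suc k) ⟩
  + suc k * - + 6        ≡⟨ ℤ.neg-distribʳ-* (+ suc k) (+ 6) ⟨
  - (+ suc k * + 6)      ≡⟨ ℤ.neg-distribˡ-* (+ suc k) (+ 6) ⟩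
  -[1+ k ] * + 6         ∎
  where open ≡-Reasoning

ε-Z^≡0 : ∀ n → ε (Z^ n) ≡ + 0 → n ≡ + 0
ε-Z^≡0 n ε≡0 = ℤ.*-cancelʳ-≡ n (+ 0) (+ 6) (trans (sym (ε-Z^ n)) ε≡0)

-- φ is onto SL₂(ℤ)

Image : M2 → Set
Image M = Σ Word λ w → φ w ≡ M

φX-⊗ : ∀ A B C D → φ X ⊗ mat A B C D ≡ mat C D (- A) (- B)
φX-⊗ A B C D =
  mat-cong (solve (A ∷ C ∷ [])) (solve (B ∷ D ∷ [])) (solve (A ∷ C ∷ [])) (solve (B ∷ D ∷ []))

φX³-⊗ : ∀ A B C D → φ (X ++ X ++ X) ⊗ mat A B C D ≡ mat (- C) (- D) A B
φX³-⊗ A B C D =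
  mat-cong (solve (A ∷ C ∷ [])) (solve (B ∷ D ∷ [])) (solve (A ∷ C ∷ [])) (solve (B ∷ D ∷ []))

φZ-⊗ : ∀ A B C D → φ Z ⊗ mat A B C D ≡ mat (- A) (- B) (- C) (- D)
φZ-⊗ A B C D =
  mat-cong (solve (A ∷ C ∷ [])) (solve (B ∷ D ∷ [])) (solve (A ∷ C ∷ [])) (solve (B ∷ D ∷ []))

φσ₁⁻¹-⊗ : ∀ A B C D → φ [ invL s₁ ] ⊗ mat A B C D ≡ mat (A - C) (B - D) C D
φσ₁⁻¹-⊗ A B C D =
  mat-cong (solve (A ∷ C ∷ [])) (solve (B ∷ D ∷ [])) (solve (A ∷ C ∷ [])) (solve (B ∷ D ∷ []))

φσ₂-⊗ : ∀ A B C D → φ [ s₂ ] ⊗ mat A B C D ≡ mat A B (C - A) (D - B)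
φσ₂-⊗ A B C D =
  mat-cong (solve (A ∷ C ∷ [])) (solve (B ∷ D ∷ [])) (solve (A ∷ C ∷ [])) (solve (B ∷ D ∷ []))

image-reduction : ∀ v {M M′} → φ v ⊗ M ≡ M′ →
                  (det M′ ≡ + 1 → Image M′) → det M ≡ + 1 → Image M
image-reduction v {M} {M′} vM≡M′ image′ det≡1 = lift (image′ det′≡1)
  where
  open ≡-Reasoning
  det′≡1 : det M′ ≡ + 1
  det′≡1 = begin
    det M′               ≡⟨ cong det vM≡M′ ⟨
    det (φ v ⊗ M)        ≡⟨ det-⊗ (φ v) M ⟩
    det (φ v) * det M    ≡⟨ cong₂ _*_ (det-φ v) det≡1 ⟩
    + 1                  ∎
  lift : Image M′ → Image M
  lift (w , φw≡M′) = invW v ++ w , (begin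
    φ (invW v ++ w)          ≡⟨ φ-++ (invW v) w ⟩
    φ (invW v) ⊗ φ w         ≡⟨ cong (φ (invW v) ⊗_) (trans φw≡M′ (sym vM≡M′)) ⟩
    φ (invW v) ⊗ (φ v ⊗ M)   ≡⟨ ⊗-assoc (φ (invW v)) (φ v) M ⟨
    (φ (invW v) ⊗ φ v) ⊗ M   ≡⟨ cong (λ P → (P ⊗ φ v) ⊗ M) (φ-invW v) ⟩
    (invSL (φ v) ⊗ φ v) ⊗ M  ≡⟨ cong (_⊗ M) (invSL-inverseˡ (φ v) (det-φ v)) ⟩
    I₂ ⊗ M                   ≡⟨ ⊗-identityˡ M ⟩
    M                        ∎)

unitriangular-⊗ : ∀ m n →
  mat (+ 1) m (+ 0) (+ 1) ⊗ mat (+ 1) n (+ 0) (+ 1) ≡ mat (+ 1) (m + n) (+ 0) (+ 1)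
unitriangular-⊗ m n = mat-cong (solve (m ∷ [])) upper refl refl
  where
  upper : + 1 * n + m * + 1 ≡ m + n
  upper = solve (m ∷ n ∷ [])

σ₁^ : ℤ → Word
σ₁^ (+ k)    = replicate k s₁
σ₁^ -[1+ k ] = replicate (suc k) (invL s₁)

φ-σ₁^ : ∀ n → φ (σ₁^ n) ≡ mat (+ 1) n (+ 0) (+ 1)
φ-σ₁^ (+ zero)       = refl
φ-σ₁^ (+ suc k)      = trans (cong (φL s₁ ⊗_) (φ-σ₁^ (+ k))) (unitriangular-⊗ (+ 1) (+ k))
φ-σ₁^ -[1+ zero ]    = refl
φ-σ₁^ -[1+ suc k ]   =
  trans (cong (φL (invL s₁) ⊗_) (φ-σ₁^ -[1+ k ])) (unitriangular-⊗ -[1+ 0 ] -[1+ k ])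

positive-unit-product : ∀ a d → + a * d ≡ + 1 → a ≡ 1 × d ≡ + 1
positive-unit-product a d ad≡1
  with ℕ.m*n≡1⇒m≡1 a ℤ.∣ d ∣ (trans (sym (ℤ.abs-* (+ a) d)) (cong ℤ.∣_∣ ad≡1))
... | refl = refl , trans (sym (ℤ.*-identityˡ d)) ad≡1

image-lower-left-zero : ∀ a b d → det (mat (+ a) b (+ 0) d) ≡ + 1 → Image (mat (+ a) b (+ 0) d)
image-lower-left-zero a b d det≡1
  with positive-unit-product a d (trans (sym (det-expand (+ a * d) b)) det≡1)
  where
  det-expand : ∀ x y → x - y * + 0 ≡ x
  det-expand = solve-∀
... | refl , refl = σ₁^ b , φ-σ₁^ b

image-nonnegative-column : ∀ n a c b d → a ℕ.+ c ℕ.≤ n →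
  det (mat (+ a) b (+ c) d) ≡ + 1 → Image (mat (+ a) b (+ c) d)
image-nonnegative-column n a zero b d _ = image-lower-left-zero a b d
image-nonnegative-column n zero (suc c) b d _ =
  image-reduction X (φX-⊗ (+ 0) b (+ suc c) d) (image-lower-left-zero (suc c) d (- b))
image-nonnegative-column (suc n) (suc a) (suc c) b d (s≤s a+1+c≤n) with ℕ.≤-total c a
... | inj₁ c≤a =
  image-reduction [ invL s₁ ]
    (trans (φσ₁⁻¹-⊗ (+ suc a) b (+ suc c) d) (mat-cong (ℤ.⊖-≥ (s≤s c≤a)) refl refl refl))
    (image-nonnegative-column n (a ∸ c) (suc c) (b - d) d
      (ℕ.≤-trans (ℕ.+-monoˡ-≤ (suc c) (ℕ.m∸n≤m a c)) a+1+c≤n))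
... | inj₂ a≤c =
  image-reduction [ s₂ ]
    (trans (φσ₂-⊗ (+ suc a) b (+ suc c) d) (mat-cong refl refl (ℤ.⊖-≥ (s≤s a≤c)) refl))
    (image-nonnegative-column n (suc a) (c ∸ a) b (d - b)
      (ℕ.≤-trans (ℕ.≤-reflexive (cong suc (ℕ.m+[n∸m]≡n a≤c)))
                 (ℕ.≤-trans (ℕ.m≤n+m (suc c) a) a+1+c≤n)))

φ-surjective : ∀ M → det M ≡ + 1 → Image M
φ-surjective (mat (+ a) b (+ c) d) =
  image-nonnegative-column _ a c b d ℕ.≤-refl
φ-surjective (mat (+ a) b -[1+ c ] d) =
  image-reduction (X ++ X ++ X) (φX³-⊗ (+ a) b -[1+ c ] d)
    (image-nonnegative-column _ (suc c) a (- d) b ℕ.≤-refl)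
φ-surjective (mat -[1+ a ] b (+ c) d) =
  image-reduction X (φX-⊗ -[1+ a ] b (+ c) d)
    (image-nonnegative-column _ c (suc a) d (- b) ℕ.≤-refl)
φ-surjective (mat -[1+ a ] b -[1+ c ] d) =
  image-reduction Z (φZ-⊗ -[1+ a ] b -[1+ c ] d)
    (image-nonnegative-column _ (suc a) (suc c) (- b) (- d) ℕ.≤-refl)

-- Normal forms

data YPow : Set where
  y¹ y² : YPow

Y^ : YPow → Word
Y^ y¹ = Y
Y^ y² = Y ++ Y

X^ : Bool → Word
X^ true  = X
X^ false = []

alt : List YPow → Bool → Word
alt []       t = X^ t
alt (i ∷ is) t = X ++ Y^ i ++ alt is t

-- x^l y^i (x y^j)⋯ x^t: together with 1 and x, the reduced words of ⟨x ∣ x²⟩ * ⟨y ∣ y³⟩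
data Reduced : Set where
  one x¹ : Reduced
  block  : Bool → YPow → List YPow → Bool → Reduced

⟦_⟧ : Reduced → Word
⟦ one ⟧            = []
⟦ x¹ ⟧             = X
⟦ block l i is t ⟧ = X^ l ++ Y^ i ++ alt is t

reduced-alt : List YPow → Bool → Reduced
reduced-alt []       false = one
reduced-alt []       true  = x¹
reduced-alt (i ∷ is) t     = block true i is t

⟦reduced-alt⟧ : ∀ is t → ⟦ reduced-alt is t ⟧ ≡ alt is t
⟦reduced-alt⟧ []       false = refl
⟦reduced-alt⟧ []       true  = refl
⟦reduced-alt⟧ (i ∷ is) t     = refl

NormalForm : Set
NormalForm = ℤ × Reduced

⌊_⌋ : NormalForm → Word
⌊ n , r ⌋ = Z^ n ++ ⟦ r ⟧

x·_ y·_ z⁻¹·_ : NormalForm → NormalForm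
x· (n , one)                = n , x¹
x· (n , x¹)                 = ℤ.suc n , one
x· (n , block false i is t) = n , block true i is t
x· (n , block true  i is t) = ℤ.suc n , block false i is t

y· (n , one)                 = n , block false y¹ [] false
y· (n , x¹)                  = n , block false y¹ [] true
y· (n , block true i is t)   = n , block false y¹ (i ∷ is) t
y· (n , block false y¹ is t) = n , block false y² is t
y· (n , block false y² is t) = ℤ.suc n , reduced-alt is t

z⁻¹· (n , r) = ℤ.pred n , r

record Realises (w : Word) (f : NormalForm → NormalForm) : Set where
  constructor realises
  field realise : ∀ N → (w ++ ⌊ N ⌋) ≈B ⌊ f N ⌋

open Realises

realises-∘ : ∀ {u v f g} → Realises u f → Realises v g → Realises (u ++ v) (f ∘ g)
realises-∘ {u} {v} {f} {g} u-f v-g = realises λ N → begin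
  (u ++ v) ++ ⌊ N ⌋   ≡⟨ ++-assoc u v ⌊ N ⌋ ⟩
  u ++ v ++ ⌊ N ⌋     ≈⟨ ++-congˡ u (realise v-g N) ⟩
  u ++ ⌊ g N ⌋        ≈⟨ realise u-f (g N) ⟩
  ⌊ f (g N) ⌋         ∎
  where open ≈B-Reasoning

realises-resp : ∀ {w} w′ {f} → (∀ t → (w ++ t) ≈B (w′ ++ t)) → Realises w′ f → Realises w f
realises-resp w′ w≈w′ w′-f = realises λ N → ≈trans (w≈w′ ⌊ N ⌋) (realise w′-f N)

x·-realises : Realises X x·_
x·-realises = realises λ (n , r) → ≈trans (commute-Z^ X-Z n ⟦ r ⟧) (absorb n r)
  where
  absorb : ∀ n r → (Z^ n ++ X ++ ⟦ r ⟧) ≈B ⌊ x· (n , r) ⌋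
  absorb n one                  = ≈refl
  absorb n x¹                   = Z^-Z n []
  absorb n (block false i is t) = ≈refl
  absorb n (block true  i is t) = Z^-Z n (Y^ i ++ alt is t)

y·-realises : Realises Y y·_
y·-realises = realises λ (n , r) → ≈trans (commute-Z^ Y-Z n ⟦ r ⟧) (absorb n r)
  where
  open ≈B-Reasoning
  absorb : ∀ n r → (Z^ n ++ Y ++ ⟦ r ⟧) ≈B ⌊ y· (n , r) ⌋
  absorb n one                   = ≈refl
  absorb n x¹                    = ≈refl
  absorb n (block true i is t)   = ≈refl
  absorb n (block false y¹ is t) = ≈refl
  absorb n (block false y² is t) = begin
    Z^ n ++ Y ++ Y ++ Y ++ alt is t      ≈⟨ ++-congˡ (Z^ n) (Z≈Y³ (alt is t)) ⟨
    Z^ n ++ Z ++ alt is t                ≈⟨ Z^-Z n (alt is t) ⟩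
    Z^ (ℤ.suc n) ++ alt is t             ≡⟨ cong (Z^ (ℤ.suc n) ++_) (⟦reduced-alt⟧ is t) ⟨
    ⌊ ℤ.suc n , reduced-alt is t ⌋       ∎

z⁻¹·-realises : Realises Z⁻¹ z⁻¹·_
z⁻¹·-realises = realises λ (n , r) → Z⁻¹-Z^ n ⟦ r ⟧

Z⁻¹-shift : ∀ c {s t} → (Z ++ s) ≈B (c ++ t) → s ≈B (Z⁻¹ ++ c ++ t)
Z⁻¹-shift c {s} Zs≈ct = ≈trans (≈sym (invW-inverseˡ Z s)) (++-congˡ Z⁻¹ Zs≈ct)

σ₁≈z⁻¹y²x : ∀ t → (s₁ ∷ t) ≈B (Z⁻¹ ++ Y ++ Y ++ X ++ t)
σ₁≈z⁻¹y²x t = Z⁻¹-shift (Y ++ Y ++ X) (≈braid X (s₁ ∷ t))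

σ₁⁻¹≈z⁻¹xy : ∀ t → (invL s₁ ∷ t) ≈B (Z⁻¹ ++ X ++ Y ++ t)
σ₁⁻¹≈z⁻¹xy t = Z⁻¹-shift (X ++ Y) (≈free (s₁ ∷ s₂ ∷ s₁ ∷ s₁ ∷ s₂ ∷ []) t s₁)

σ₂≈z⁻¹xy² : ∀ t → (s₂ ∷ t) ≈B (Z⁻¹ ++ X ++ Y ++ Y ++ t)
σ₂≈z⁻¹xy² t = Z⁻¹-shift (X ++ Y ++ Y) ≈refl

σ₂⁻¹≈z⁻¹yx : ∀ t → (invL s₂ ∷ t) ≈B (Z⁻¹ ++ Y ++ X ++ t)
σ₂⁻¹≈z⁻¹yx t = Z⁻¹-shift (Y ++ X)
  (≈trans (Z≈Y³ (invL s₂ ∷ t)) (≈free (s₁ ∷ s₂ ∷ s₁ ∷ s₂ ∷ s₁ ∷ []) t s₂))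

act : Letter → NormalForm → NormalForm
act (σ₁ , true)  = z⁻¹·_ ∘ y·_ ∘ y·_ ∘ x·_
act (σ₁ , false) = z⁻¹·_ ∘ x·_ ∘ y·_
act (σ₂ , true)  = z⁻¹·_ ∘ x·_ ∘ y·_ ∘ y·_
act (σ₂ , false) = z⁻¹·_ ∘ y·_ ∘ x·_

act-realises : ∀ l → Realises [ l ] (act l)
act-realises (σ₁ , true)  = realises-resp (Z⁻¹ ++ Y ++ Y ++ X) σ₁≈z⁻¹y²x
  (realises-∘ z⁻¹·-realises (realises-∘ y·-realises (realises-∘ y·-realises x·-realises)))
act-realises (σ₁ , false) = realises-resp (Z⁻¹ ++ X ++ Y) σ₁⁻¹≈z⁻¹xy
  (realises-∘ z⁻¹·-realises (realises-∘ x·-realises y·-realises))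
act-realises (σ₂ , true)  = realises-resp (Z⁻¹ ++ X ++ Y ++ Y) σ₂≈z⁻¹xy²
  (realises-∘ z⁻¹·-realises (realises-∘ x·-realises (realises-∘ y·-realises y·-realises)))
act-realises (σ₂ , false) = realises-resp (Z⁻¹ ++ Y ++ X) σ₂⁻¹≈z⁻¹yx
  (realises-∘ z⁻¹·-realises (realises-∘ y·-realises x·-realises))

nf : Word → NormalForm
nf []      = + 0 , one
nf (l ∷ u) = act l (nf u)

nf-correct : ∀ u → u ≈B ⌊ nf u ⌋
nf-correct []      = ≈refl
nf-correct (l ∷ u) = ≈trans (++-congˡ [ l ] (nf-correct u)) (realise (act-realises l) (nf u))

-- Reduced words other than 1 do not map to ±I

φxy : YPow → M2
φxy i = φ (X ++ Y^ i)

φxy* : List YPow → M2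
φxy* is = φ (alt is false)

φ-alt-∷ : ∀ i is t → φ (alt (i ∷ is) t) ≡ φxy i ⊗ φ (alt is t)
φ-alt-∷ i is t = trans (cong φ (sym (++-assoc X (Y^ i) (alt is t)))) (φ-++ (X ++ Y^ i) (alt is t))

φ-alt : ∀ is t → φ (alt is t) ≡ φxy* is ⊗ φ (X^ t)
φ-alt []       t = sym (⊗-identityˡ (φ (X^ t)))
φ-alt (i ∷ is) t = begin
  φ (alt (i ∷ is) t)              ≡⟨ φ-alt-∷ i is t ⟩
  φxy i ⊗ φ (alt is t)            ≡⟨ cong (φxy i ⊗_) (φ-alt is t) ⟩
  φxy i ⊗ (φxy* is ⊗ φ (X^ t))    ≡⟨ ⊗-assoc (φxy i) (φxy* is) (φ (X^ t)) ⟨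
  (φxy i ⊗ φxy* is) ⊗ φ (X^ t)    ≡⟨ cong (_⊗ φ (X^ t)) (φ-alt-∷ i is false) ⟨
  φxy* (i ∷ is) ⊗ φ (X^ t)        ∎
  where open ≡-Reasoning

-- ± D P D with D = diag(1, -1) and P ≠ I a nonnegative matrix with positive diagonal
data Checkered (M : M2) : Set where
  checkered⁺ : ∀ p q r s → q ℕ.+ r ≢ 0 →
               M ≡ mat (+ suc p) (- + q) (- + r) (+ suc s) → Checkered M
  checkered⁻ : ∀ p q r s → q ℕ.+ r ≢ 0 →
               M ≡ mat -[1+ p ] (+ q) (+ r) -[1+ s ] → Checkered M

xy¹-⊗⁺ : ∀ P Q R S → φxy y¹ ⊗ mat P (- Q) (- R) S ≡ mat (- (P + R)) (S + Q) R (- S)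
xy¹-⊗⁺ P Q R S =
  mat-cong (solve (P ∷ R ∷ [])) (solve (Q ∷ S ∷ [])) (solve (P ∷ R ∷ [])) (solve (Q ∷ S ∷ []))

xy¹-⊗⁻ : ∀ P Q R S → φxy y¹ ⊗ mat (- P) Q R (- S) ≡ mat (P + R) (- (S + Q)) (- R) S
xy¹-⊗⁻ P Q R S =
  mat-cong (solve (P ∷ R ∷ [])) (solve (Q ∷ S ∷ [])) (solve (P ∷ R ∷ [])) (solve (Q ∷ S ∷ []))

xy²-⊗⁺ : ∀ P Q R S → φxy y² ⊗ mat P (- Q) (- R) S ≡ mat (- P) Q (P + R) (- (S + Q))
xy²-⊗⁺ P Q R S =
  mat-cong (solve (P ∷ R ∷ [])) (solve (Q ∷ S ∷ [])) (solve (P ∷ R ∷ [])) (solve (Q ∷ S ∷ []))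

xy²-⊗⁻ : ∀ P Q R S → φxy y² ⊗ mat (- P) Q R (- S) ≡ mat P (- Q) (- (P + R)) (S + Q)
xy²-⊗⁻ P Q R S =
  mat-cong (solve (P ∷ R ∷ [])) (solve (Q ∷ S ∷ [])) (solve (P ∷ R ∷ [])) (solve (Q ∷ S ∷ []))

xy-⊗-checkered : ∀ i {M} → Checkered M → Checkered (φxy i ⊗ M)
xy-⊗-checkered y¹ (checkered⁺ p q r s _ refl) =
  checkered⁻ (p ℕ.+ r) (suc (s ℕ.+ q)) r s (λ ()) (xy¹-⊗⁺ (+ suc p) (+ q) (+ r) (+ suc s))
xy-⊗-checkered y¹ (checkered⁻ p q r s _ refl) =
  checkered⁺ (p ℕ.+ r) (suc (s ℕ.+ q)) r s (λ ()) (xy¹-⊗⁻ (+ suc p) (+ q) (+ r) (+ suc s))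
xy-⊗-checkered y² (checkered⁺ p q r s _ refl) =
  checkered⁻ p q (suc (p ℕ.+ r)) (s ℕ.+ q) (ℕ.m+1+n≢0 q) (xy²-⊗⁺ (+ suc p) (+ q) (+ r) (+ suc s))
xy-⊗-checkered y² (checkered⁻ p q r s _ refl) =
  checkered⁺ p q (suc (p ℕ.+ r)) (s ℕ.+ q) (ℕ.m+1+n≢0 q) (xy²-⊗⁻ (+ suc p) (+ q) (+ r) (+ suc s))

φxy*-checkered : ∀ i is → Checkered (φxy* (i ∷ is))
φxy*-checkered y¹ []       = checkered⁻ 0 1 0 0 (λ ()) refl
φxy*-checkered y² []       = checkered⁻ 0 0 1 0 (λ ()) refl
φxy*-checkered i  (j ∷ js) =
  subst Checkered (sym (φ-alt-∷ i (j ∷ js) false)) (xy-⊗-checkered i (φxy*-checkered j js))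

checkered-diagonal : ∀ {M} → Checkered M → a M ≢ + 0 × d M ≢ + 0
checkered-diagonal (checkered⁺ p q r s _ refl) = (λ ()) , (λ ())
checkered-diagonal (checkered⁻ p q r s _ refl) = (λ ()) , (λ ())

checkered-¬±I : ∀ {M} → Checkered M → ¬ ±I M
checkered-¬±I (checkered⁺ p q r s q+r≢0 refl) (inj₁ M≡I) =
  q+r≢0 (cong₂ ℕ._+_ (-+≡0 (cong b M≡I)) (-+≡0 (cong c M≡I)))
  where
  -+≡0 : ∀ {n} → - + n ≡ + 0 → n ≡ 0
  -+≡0 e = ℤ.+-injective (ℤ.neg-injective e)
checkered-¬±I (checkered⁺ p q r s _ refl) (inj₂ ())
checkered-¬±I (checkered⁻ p q r s _ refl) (inj₁ ())
checkered-¬±I (checkered⁻ p q r s q+r≢0 refl) (inj₂ M≡-I) =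
  q+r≢0 (cong₂ ℕ._+_ (ℤ.+-injective (cong b M≡-I)) (ℤ.+-injective (cong c M≡-I)))

φxy*-diagonal : ∀ is → a (φxy* is) ≢ + 0 × d (φxy* is) ≢ + 0
φxy*-diagonal []       = (λ ()) , (λ ())
φxy*-diagonal (i ∷ is) = checkered-diagonal (φxy*-checkered i is)

⊗-φX : ∀ M → M ⊗ φ X ≡ mat (- b M) (a M) (- d M) (c M)
⊗-φX (mat A B C D) =
  mat-cong (solve (A ∷ B ∷ [])) (solve (A ∷ B ∷ [])) (solve (C ∷ D ∷ [])) (solve (C ∷ D ∷ []))

±I-b : ∀ {E} → ±I E → b E ≡ + 0
±I-b (inj₁ refl) = refl
±I-b (inj₂ refl) = refl

alt-¬±I : ∀ i is t → ¬ ±I (φ (alt (i ∷ is) t))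
alt-¬±I i is false = checkered-¬±I (φxy*-checkered i is)
alt-¬±I i is true  ±I-alt = proj₁ (checkered-diagonal (φxy*-checkered i is)) (begin
  a (φxy* (i ∷ is))            ≡⟨ cong b (⊗-φX (φxy* (i ∷ is))) ⟨
  b (φxy* (i ∷ is) ⊗ φ X)      ≡⟨ cong b (φ-alt (i ∷ is) true) ⟨
  b (φ (alt (i ∷ is) true))    ≡⟨ ±I-b ±I-alt ⟩
  + 0                          ∎)
  where open ≡-Reasoning

alt-++-Y^ : ∀ is i → alt is true ++ Y^ i ≡ alt (is ∷ʳ i) false
alt-++-Y^ []       i = cong (X ++_) (sym (++-identityʳ (Y^ i)))
alt-++-Y^ (j ∷ js) i =
  cong (X ++_) (trans (++-assoc (Y^ j) (alt js true) (Y^ i)) (cong (Y^ j ++_) (alt-++-Y^ js i)))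

alt-∷ʳ-¬±I : ∀ is i → ¬ ±I (φ (alt (is ∷ʳ i) false))
alt-∷ʳ-¬±I []       i = alt-¬±I i [] false
alt-∷ʳ-¬±I (j ∷ js) i = alt-¬±I j (js ∷ʳ i) false

Y⁻¹-corner : ∀ i {E} → ±I E →
  a (φ (invW (Y^ i)) ⊗ E) ≡ + 0 ⊎ d (φ (invW (Y^ i)) ⊗ E) ≡ + 0
Y⁻¹-corner y¹ (inj₁ refl) = inj₂ refl
Y⁻¹-corner y¹ (inj₂ refl) = inj₂ refl
Y⁻¹-corner y² (inj₁ refl) = inj₁ refl
Y⁻¹-corner y² (inj₂ refl) = inj₁ refl

φ-reduced-±I : ∀ r → ±I (φ ⟦ r ⟧) → r ≡ one
φ-reduced-±I one _ = refl
φ-reduced-±I x¹ (inj₁ ())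
φ-reduced-±I x¹ (inj₂ ())
φ-reduced-±I (block true i is t) ±I-r = ⊥-elim (alt-¬±I i is t ±I-r)
φ-reduced-±I (block false i is true) ±I-r =
  ⊥-elim (alt-∷ʳ-¬±I is i
    (subst (±I ∘ φ) (alt-++-Y^ is i) (±I-φ-rotate (Y^ i) (alt is true) ±I-r)))
φ-reduced-±I (block false i is false) ±I-r with Y⁻¹-corner i ±I-r | φxy*-diagonal is
... | inj₁ a≡0 | a≢0 , _ = ⊥-elim (a≢0 (trans (cong a (φ-cancelˡ (Y^ i) (alt is false))) a≡0))
... | inj₂ d≡0 | _ , d≢0 = ⊥-elim (d≢0 (trans (cong d (φ-cancelˡ (Y^ i) (alt is false))) d≡0))

-- The kernel of (φ, ε)

normal-form-kernel : ∀ N → φ ⌊ N ⌋ ≡ I₂ → ε ⌊ N ⌋ ≡ + 0 → N ≡ (+ 0 , one)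
normal-form-kernel (n , r) φ≡I ε≡0
  with φ-reduced-±I r (±I-cancel (±I-φ-Z^ n) (trans (sym (φ-++ (Z^ n) ⟦ r ⟧)) φ≡I))
... | refl = cong (_, one) (ε-Z^≡0 n (trans (cong ε (sym (++-identityʳ (Z^ n)))) ε≡0))

kernel-trivial : ∀ u → φ u ≡ I₂ → ε u ≡ + 0 → u ≈B []
kernel-trivial u φ≡I ε≡0 = subst (u ≈B_) (cong ⌊_⌋ nf≡1) (nf-correct u)
  where
  nf≡1 : nf u ≡ (+ 0 , one)
  nf≡1 = normal-form-kernel (nf u) (trans (sym (φ-resp (nf-correct u))) φ≡I)
                                   (trans (sym (ε-resp (nf-correct u))) ε≡0)

φε-injective : ∀ u v → φ u ≡ φ v → ε u ≡ ε v → u ≈B v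
φε-injective u v φu≡φv εu≡εv = ≈B-of-inverse u v (kernel-trivial (u ++ invW v) φ≡I ε≡0)
  where
  open ≡-Reasoning
  φ≡I : φ (u ++ invW v) ≡ I₂
  φ≡I = begin
    φ (u ++ invW v)         ≡⟨ φ-++ u (invW v) ⟩
    φ u ⊗ φ (invW v)        ≡⟨ cong₂ _⊗_ φu≡φv (φ-invW v) ⟩
    φ v ⊗ invSL (φ v)       ≡⟨ invSL-inverseʳ (φ v) (det-φ v) ⟩
    I₂                      ∎
  ε≡0 : ε (u ++ invW v) ≡ + 0
  ε≡0 = begin
    ε (u ++ invW v)         ≡⟨ ε-++ u (invW v) ⟩
    ε u + ε (invW v)        ≡⟨ cong₂ _+_ εu≡εv (ε-invW v) ⟩
    ε v + - ε v             ≡⟨ ℤ.+-inverseʳ (ε v) ⟩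
    + 0                     ∎

proposition2p5 : (g h : Word) →
    (ConjB g h → ConjSL (φ g) (φ h) × (ε g ≡ ε h)) ×
    (ConjSL (φ g) (φ h) × (ε g ≡ ε h) → ConjB g h)
proposition2p5 g h = conjugate⇒ , ⇒conjugate
  where
  conjugate⇒ : ConjB g h → ConjSL (φ g) (φ h) × (ε g ≡ ε h)
  conjugate⇒ (w , wgw⁻¹≈h) =
    (φ w , det-φ w , trans (sym (φ-conj w g)) (φ-resp wgw⁻¹≈h)) ,
    trans (sym (ε-conj w g)) (ε-resp wgw⁻¹≈h)
  ⇒conjugate : ConjSL (φ g) (φ h) × (ε g ≡ ε h) → ConjB g h
  ⇒conjugate ((P , det≡1 , PgP⁻¹≡h) , εg≡εh) with φ-surjective P det≡1
  ... | w , refl = w , φε-injective (w ++ g ++ invW w) h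
                         (trans (φ-conj w g) PgP⁻¹≡h) (trans (ε-conj w g) εg≡εh)
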